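{- (1) If $t\to s$ then $s\le t$. (2) The reduction relation $\to$ on $\mathcal F_0$ is strongly normalizing. (3) The simple terms of $\mathcal F_0$ that are in $\to$-normal form are exactly those generated by the grammar $t ::= \mathtt C\,t \mid \{\mathtt D_1=t_1;\dots;\mathtt D_n=t_n\} \mid \maltese\,\delta \mid \delta$, $\quad \delta ::= \mathtt C^-\,\delta \mid \mathtt D\,\delta \mid \mathtt x \mid \mathtt g\,t$.
   Context: Fix finite sets of constructor names ($\mathtt C,\mathtt C',\dots$), destructor/field names ($\mathtt D,\mathtt D_1,\dots$) and function names ($\mathtt g,\dots$). (Every occurrence of a constructor or destructor also carries a priority, a natural number, odd for constructors and even for destructors; priorities play no role below and are omitted.) The set $\mathcal F_0$ of terms is generated by $t ::= \mathtt C\,t \mid \{\mathtt D_1=t_1;\dots;\mathtt D_n=t_n\} \mid \mathtt C^-\,t \mid \mathtt D\,t \mid \mathtt g\,t \mid \mathtt x \mid \maltese t \mid t_1+\dots+t_n$, where $\mathtt x$ is the only variable, records have distinct field names, and sums may have any number $n\ge 0$ of summands (the empty sum is written $0$). Terms are quotiented by associativity, commutativity and idempotence of $+$, and by (multi)linearity of all term formers with respect to $+$; e.g. $\mathtt C(s+t)=\mathtt C s+\mathtt C t$ and $\mathtt C\,0=0$. A term is simple if it contains no sum (empty or otherwise). The preorder $\le$ on $\mathcal F_0$ is the smallest reflexive and transitive relation such that: $t\le 0$ for all $t$; if $t_1\le t_2$ then $K[t_1]\le K[t_2]$ for every context $K$ (a term with a hole); $\maltese\mathtt x\le\mathtt x$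 and $\maltese\mathtt x\le \mathtt g\,\mathtt x$ for every function name $\mathtt g$; $s+t\le t$; and the following list (*), where $u\approx v$ means ($u\le v$ and $v\le u$): $\mathtt C^-\mathtt C t\approx t$; $\mathtt D_{i_0}\{\dots;\mathtt D_i=t_i;\dots\}\ge t_{i_0}$; $\mathtt C^-\{\dots\}\approx 0$; $\mathtt D\,\mathtt C t\approx 0$; $\mathtt D\{\dots\}\approx 0$ if the record has no field $\mathtt D$; $\mathtt C^-\mathtt C' t\approx 0$ if $\mathtt C\ne\mathtt C'$; $\mathtt C^-\maltese t\approx\maltese t$; $\mathtt D\maltese t\approx \maltese t$; $\maltese\mathtt C t\approx\maltese t$; $\maltese\{\mathtt D_1=t_1;\dots;\mathtt D_n=t_n\}\ge \maltese t_1+\dots+\maltese t_n$ for $n>0$; $\maltese\maltese t\approx \maltese t$. The reduction relation $\to$ is the contextual closure of the left-to-right orientation of the (in)equalities in (*) (each written with the larger-or-equal left-hand side as written: e.g. $\mathtt C^-\mathtt C t\to t$, $\mathtt D_{i_0}\{\dots;\mathtt D_i=t_i;\dots\}\to t_{i_0}$, $\maltese\{\mathtt D_1=t_1;\dots\}\to\maltese t_1+\dots+\maltese t_n$, $\mathtt D\,\mathtt C t\to 0$, etc.). -}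

module Defs where

open import Data.Nat using (ℕ)
open import Data.Fin using (Fin)
open import Data.Maybe using (Maybe; just; nothing)
open import Data.Vec using (Vec; []; _∷_; lookup; _[_]≔_)
open import Data.List using (List; []; _∷_; map; _++_; concat; concatMap; [_])
open import Data.List.Membership.Propositional using (_∈_; _∉_)
open import Data.List.Relation.Unary.All using (All)
open import Data.Product using (_×_; ∃; Σ)
open import Relation.Binary.PropositionalEquality using (_≡_; _≢_)
open import Relation.Nullary using (¬_)

-- Terms of F_0, represented in canonical form modulo the quotient
-- (ACI of + and multilinearity of all term formers): a term is a finite
-- SET of simple terms (a list, compared up to having the same elements),
-- and simple terms have simple immediate subterms.
-- A record is a vector indexed by all field names, `just` for present
-- fields (so field names are automatically distinct, order irrelevant).
module F0 (nC nD nG : ℕ) where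

  data S : Set where
    con : Fin nC → S → S
    rec : Vec (Maybe S) nD → S
    des : Fin nC → S → S
    fld : Fin nD → S → S
    app : Fin nG → S → S
    var : S
    mal : S → S

  Term : Set
  Term = List S

  fields : ∀ {A : Set} {n} → Vec (Maybe A) n → List A
  fields [] = []
  fields (nothing ∷ v) = fields v
  fields (just a ∷ v) = a ∷ fields v

  NonEmptyR : ∀ {A : Set} {n} → Vec (Maybe A) n → Set
  NonEmptyR {A} {n} r = Σ (Fin n) λ d → Σ A λ a → lookup r d ≡ just a

  data WF : S → Set where
    con : ∀ {c u} → WF u → WF (con c u)
    rec : ∀ {r} → NonEmptyR r → (∀ d u → lookup r d ≡ just u → WF u) → WF (rec r)
    des : ∀ {c u} → WF u → WF (des c u)
    fld : ∀ {d u} → WF u → WF (fld d u)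
    app : ∀ {g u} → WF u → WF (app g u)
    var : WF var
    mal : ∀ {u} → WF u → WF (mal u)

  WFₜ : Term → Set
  WFₜ = All WF

  _≈ₜ_ : Term → Term → Set
  t ≈ₜ s = ∀ u → (u ∈ t → u ∈ s) × (u ∈ s → u ∈ t)

  conT : Fin nC → Term → Term
  conT c = map (con c)
  desT : Fin nC → Term → Term
  desT c = map (des c)
  fldT : Fin nD → Term → Term
  fldT d = map (fld d)
  appT : Fin nG → Term → Term
  appT g = map (app g)
  malT : Term → Term
  malT = map mal

  -- multilinear expansion of a record whose fields are terms
  prod : ∀ {n} → Vec (Maybe Term) n → List (Vec (Maybe S) n)
  prod [] = [ [] ]
  prod (nothing ∷ v) = map (nothing ∷_) (prod v)
  prod (just t ∷ v) = concatMap (λ u → map (just u ∷_) (prod v)) t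

  recT : Vec (Maybe Term) nD → Term
  recT r = map rec (prod r)

  data _≤ₜ_ : Term → Term → Set where
    ≈⇒≤ : ∀ {t s} → t ≈ₜ s → t ≤ₜ s
    ≤-trans : ∀ {t s r} → t ≤ₜ s → s ≤ₜ r → t ≤ₜ r
    ≤-zero : ∀ {t} → t ≤ₜ []
    ≤-sum : ∀ {s t} → (s ++ t) ≤ₜ t
    ctx-sum : ∀ {t s} u → t ≤ₜ s → (t ++ u) ≤ₜ (s ++ u)
    ctx-con : ∀ {t s} c → t ≤ₜ s → conT c t ≤ₜ conT c s
    ctx-des : ∀ {t s} c → t ≤ₜ s → desT c t ≤ₜ desT c s
    ctx-fld : ∀ {t s} d → t ≤ₜ s → fldT d t ≤ₜ fldT d s
    ctx-app : ∀ {t s} g → t ≤ₜ s → appT g t ≤ₜ appT g s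
    ctx-mal : ∀ {t s} → t ≤ₜ s → malT t ≤ₜ malT s
    ctx-rec : ∀ {t s} (r : Vec (Maybe Term) nD) d → t ≤ₜ s →
              recT (r [ d ]≔ just t) ≤ₜ recT (r [ d ]≔ just s)
    mal-var : [ mal var ] ≤ₜ [ var ]
    mal-app : ∀ g → [ mal var ] ≤ₜ [ app g var ]
    -- the list (*); u ≈ v gives both directions
    desCon₁ : ∀ c t → desT c (conT c t) ≤ₜ t
    desCon₂ : ∀ c t → t ≤ₜ desT c (conT c t)
    fldRec : ∀ d (r : Vec (Maybe Term) nD) t → lookup r d ≡ just t → t ≤ₜ fldT d (recT r)
    desRec₁ : ∀ c (r : Vec (Maybe Term) nD) → NonEmptyR r → desT c (recT r) ≤ₜ []
    desRec₂ : ∀ c (r : Vec (Maybe Term) nD) → NonEmptyR r → [] ≤ₜ desT c (recT r)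
    fldCon₁ : ∀ d c t → fldT d (conT c t) ≤ₜ []
    fldCon₂ : ∀ d c t → [] ≤ₜ fldT d (conT c t)
    fldRecNo₁ : ∀ d (r : Vec (Maybe Term) nD) → NonEmptyR r → lookup r d ≡ nothing →
                fldT d (recT r) ≤ₜ []
    fldRecNo₂ : ∀ d (r : Vec (Maybe Term) nD) → NonEmptyR r → lookup r d ≡ nothing →
                [] ≤ₜ fldT d (recT r)
    desCon'₁ : ∀ c c' t → c ≢ c' → desT c (conT c' t) ≤ₜ []
    desCon'₂ : ∀ c c' t → c ≢ c' → [] ≤ₜ desT c (conT c' t)
    desMal₁ : ∀ c t → desT c (malT t) ≤ₜ malT t
    desMal₂ : ∀ c t → malT t ≤ₜ desT c (malT t)
    fldMal₁ : ∀ d t → fldT d (malT t) ≤ₜ malT t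
    fldMal₂ : ∀ d t → malT t ≤ₜ fldT d (malT t)
    malCon₁ : ∀ c t → malT (conT c t) ≤ₜ malT t
    malCon₂ : ∀ c t → malT t ≤ₜ malT (conT c t)
    malRec : ∀ (r : Vec (Maybe Term) nD) → NonEmptyR r →
             concatMap malT (fields r) ≤ₜ malT (recT r)
    malMal₁ : ∀ t → malT (malT t) ≤ₜ malT t
    malMal₂ : ∀ t → malT t ≤ₜ malT (malT t)

  data _⟶_ : S → Term → Set where
    -- left-to-right orientation of (*)
    r-desCon : ∀ c u → des c (con c u) ⟶ [ u ]
    r-fldRec : ∀ d r u → lookup r d ≡ just u → fld d (rec r) ⟶ [ u ]
    r-desRec : ∀ c r → des c (rec r) ⟶ []
    r-fldCon : ∀ d c u → fld d (con c u) ⟶ []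
    r-fldRecNo : ∀ d r → lookup r d ≡ nothing → fld d (rec r) ⟶ []
    r-desCon' : ∀ c c' u → c ≢ c' → des c (con c' u) ⟶ []
    r-desMal : ∀ c u → des c (mal u) ⟶ [ mal u ]
    r-fldMal : ∀ d u → fld d (mal u) ⟶ [ mal u ]
    r-malCon : ∀ c u → mal (con c u) ⟶ [ mal u ]
    r-malRec : ∀ r → NonEmptyR r → mal (rec r) ⟶ map mal (fields r)
    r-malMal : ∀ u → mal (mal u) ⟶ [ mal u ]
    c-con : ∀ c {u R} → u ⟶ R → con c u ⟶ map (con c) R
    c-des : ∀ c {u R} → u ⟶ R → des c u ⟶ map (des c) R
    c-fld : ∀ d {u R} → u ⟶ R → fld d u ⟶ map (fld d) R
    c-app : ∀ g {u R} → u ⟶ R → app g u ⟶ map (app g) R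
    c-mal : ∀ {u R} → u ⟶ R → mal u ⟶ map mal R
    c-rec : ∀ r d {u R} → lookup r d ≡ just u → u ⟶ R →
            rec r ⟶ map (λ v → rec (r [ d ]≔ just v)) R

  data _⟶ₜ_ (t s : Term) : Set where
    step : ∀ u R rest → u ⟶ R → u ∉ rest →
           t ≈ₜ (u ∷ rest) → s ≈ₜ (rest ++ R) → t ⟶ₜ s

  Normalₜ : Term → Set
  Normalₜ t = ∀ s → ¬ (t ⟶ₜ s)

  data NT : S → Set
  data Nδ : S → Set
  data NT where
    con : ∀ {c u} → NT u → NT (con c u)
    rec : ∀ {r} → NonEmptyR r → (∀ d u → lookup r d ≡ just u → NT u) → NT (rec r)
    mal : ∀ {u} → Nδ u → NT (mal u)
    δ : ∀ {u} → Nδ u → NT u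
  data Nδ where
    des : ∀ {c u} → Nδ u → Nδ (des c u)
    fld : ∀ {d u} → Nδ u → Nδ (fld d u)
    var : Nδ var
    app : ∀ {g u} → NT u → Nδ (app g u)

-- (1) Each rule of (*) is oriented from its larger side, and ≤ is closed under
-- contexts and sums. (2) Every rewrite step replaces one summand u by summands
-- strictly smaller than u; the induced order on finite sets of summands is
-- well founded whenever the order on summands is, so size decreases suffice.
-- (3) Normality of the one-summand term u just says that u has no redex; the
-- subterms of an irreducible term are irreducible, and directly below ✠, C⁻
-- and D an irreducible subterm must be a δ-term, since every other normal
-- form creates a redex there.
module Submission where

open import Defs
open import Data.Nat using (ℕ; suc; _+_; _<_; _≤_; s≤s)
import Data.Nat.Properties as ℕₚ
open import Data.Nat.Induction using (<-wellFounded)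
open import Data.Fin using (zero; suc; _≟_)
open import Data.Maybe using (Maybe; just; nothing)
import Data.Maybe as Maybe
open import Data.Vec using (Vec; []; _∷_; lookup; _[_]≔_)
import Data.Vec as Vec
open import Data.Vec.Properties using (lookup-map; []≔-lookup)
open import Data.List using (List; []; _∷_; map; _++_; concatMap; [_])
open import Data.List.Properties using (map-∘; ++-identityʳ; concatMap-map; concatMap-pure)
open import Data.List.Membership.Propositional using (_∈_)
open import Data.List.Membership.Propositional.Properties using (∈-++⁻; ∈-++⁺ˡ; ∈-++⁺ʳ)
open import Data.List.Relation.Binary.Subset.Propositional using (_⊆_)
open import Data.List.Relation.Binary.Permutation.Propositional.Properties using (∈-resp-↭; ++-comm)
open import Data.List.Relation.Unary.Any using (here; there)
open import Data.List.Relation.Unary.All using (All; []; _∷_)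
import Data.List.Relation.Unary.All as All
open import Data.List.Relation.Unary.All.Properties using (map⁺)
open import Data.Product using (_×_; _,_; proj₁; proj₂; ∃)
open import Data.Sum using (_⊎_; inj₁; inj₂)
import Data.Sum as Sum
open import Data.Empty using (⊥-elim)
open import Function using (flip; _on_; _⇔_; mk⇔)
open import Function.Construct.Composition using (_⇔-∘_)
open import Induction.WellFounded using (Acc; acc; WellFounded; module Subrelation)
open import Relation.Binary.Construct.On using (wellFounded)
open import Relation.Nullary using (¬_; yes; no)
open import Relation.Binary.PropositionalEquality using (_≡_; _≢_; refl; sym; trans; cong; subst; subst₂)

module FiniteSetExtension {A : Set} (_<_ : A → A → Set) where

  _⊏_ : List A → List A → Set
  s ⊏ t = ∃ λ u → u ∈ t × (∀ {z} → z ∈ s → (z ∈ t × z ≢ u) ⊎ z < u)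

  ⊏-monoʳ : ∀ {s t t′} → t ⊆ t′ → s ⊏ t → s ⊏ t′
  ⊏-monoʳ t⊆t′ (u , u∈t , below) =
    u , t⊆t′ u∈t , λ z∈s → Sum.map₁ (λ (z∈t , z≢u) → t⊆t′ z∈t , z≢u) (below z∈s)

  acc-⊆ : ∀ {s t} → s ⊆ t → Acc _⊏_ t → Acc _⊏_ s
  acc-⊆ s⊆t (acc rs) = acc λ r⊏s → rs (⊏-monoʳ s⊆t r⊏s)

  split : {P Q : A → Set} (s : List A) → (∀ {z} → z ∈ s → P z ⊎ Q z) →
          ∃ λ s′ → (∀ {z} → z ∈ s′ → Q z) × (∀ {z} → z ∈ s → P z ⊎ z ∈ s′)
  split [] _ = [] , (λ ()) , (λ ())
  split (x ∷ s) pq with split s (λ z∈s → pq (there z∈s)) | pq (here refl)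
  ... | s′ , q , cover | inj₁ px =
    s′ , q , λ { (here refl) → inj₁ px ; (there z∈s) → cover z∈s }
  ... | s′ , q , cover | inj₂ qx =
    x ∷ s′ , (λ { (here refl) → qx ; (there z∈s′) → q z∈s′ }) ,
    λ { (here refl) → inj₂ (here refl) ; (there z∈s) → Sum.map₂ there (cover z∈s) }

  Good : A → Set
  Good a = ∀ {b} → b < a → ∀ {l} → Acc _⊏_ l → Acc _⊏_ (b ∷ l)

  acc-++ : ∀ {a l} → Good a → Acc _⊏_ l → (s : List A) →
           (∀ {z} → z ∈ s → z ∈ l ⊎ z < a) → Acc _⊏_ (s ++ l)
  acc-++ good accl [] _ = accl
  acc-++ good accl (x ∷ s) below
    with acc-++ good accl s (λ z∈s → below (there z∈s)) | below (here refl)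
  ... | acc-s++l | inj₁ x∈l = acc-⊆ (λ { (here refl) → ∈-++⁺ʳ s x∈l ; (there m) → m }) acc-s++l
  ... | acc-s++l | inj₂ x<a = good x<a acc-s++l

  -- Nipkow's proof of well-foundedness of the multiset extension, read on sets.
  acc-∷ : ∀ {a l} → Good a → Acc _⊏_ l → Acc _⊏_ (a ∷ l)
  acc-∷ {a} {l} good (acc rs) = acc decrease
    where
    removed-a : ∀ {z} → (z ∈ a ∷ l × z ≢ a) ⊎ z < a → z ∈ l ⊎ z < a
    removed-a (inj₁ (here refl , z≢a)) = ⊥-elim (z≢a refl)
    removed-a (inj₁ (there z∈l , _)) = inj₁ z∈l
    removed-a (inj₂ z<a) = inj₂ z<a

    removed-in-l : ∀ {u z} → (z ∈ a ∷ l × z ≢ u) ⊎ z < u → z ≡ a ⊎ ((z ∈ l × z ≢ u) ⊎ z < u)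
    removed-in-l (inj₁ (here refl , _)) = inj₁ refl
    removed-in-l (inj₁ (there z∈l , z≢u)) = inj₂ (inj₁ (z∈l , z≢u))
    removed-in-l (inj₂ z<u) = inj₂ (inj₂ z<u)

    decrease : ∀ {s} → s ⊏ (a ∷ l) → Acc _⊏_ s
    decrease {s} (u , here refl , below) =
      acc-⊆ ∈-++⁺ˡ (acc-++ good (acc rs) s (λ z∈s → removed-a (below z∈s)))
    decrease {s} (u , there u∈l , below)
      with s′ , s′⊏l , cover ← split s (λ z∈s → removed-in-l (below z∈s)) =
      acc-⊆ (λ z∈s → Sum.[ (λ { refl → here refl }) , there ] (cover z∈s))
            (acc-∷ good (rs (u , u∈l , s′⊏l)))

  acc⇒good : ∀ {a} → Acc _<_ a → Good a
  acc⇒good (acc rs) b<a = acc-∷ (acc⇒good (rs b<a))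

  ⊏-wellFounded : WellFounded _<_ → WellFounded _⊏_
  ⊏-wellFounded wf [] = acc λ { (_ , () , _) }
  ⊏-wellFounded wf (a ∷ l) = acc-∷ (acc⇒good (wf a)) (⊏-wellFounded wf l)

module _ (nC nD nG : ℕ) where
  open F0 nC nD nG

  singletons : ∀ {n} → Vec (Maybe S) n → Vec (Maybe Term) n
  singletons = Vec.map (Maybe.map [_])

  prod-singletons : ∀ {n} (r : Vec (Maybe S) n) → prod (singletons r) ≡ [ r ]
  prod-singletons [] = refl
  prod-singletons (nothing ∷ r) rewrite prod-singletons r = refl
  prod-singletons (just u ∷ r) rewrite prod-singletons r = refl

  recT-singletons : ∀ (r : Vec (Maybe S) nD) → recT (singletons r) ≡ [ rec r ]
  recT-singletons r = cong (map rec) (prod-singletons r)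

  lookup-singletons : ∀ {n} (r : Vec (Maybe S) n) d {x} → lookup r d ≡ x →
                      lookup (singletons r) d ≡ Maybe.map [_] x
  lookup-singletons r d eq = trans (lookup-map d (Maybe.map [_]) r) (cong (Maybe.map [_]) eq)

  nonEmpty-singletons : ∀ {n} (r : Vec (Maybe S) n) → NonEmptyR r → NonEmptyR (singletons r)
  nonEmpty-singletons r (d , u , eq) = d , [ u ] , lookup-singletons r d eq

  malT-fields-singletons : ∀ {n} (r : Vec (Maybe S) n) →
                           concatMap malT (fields (singletons r)) ≡ map mal (fields r)
  malT-fields-singletons [] = refl
  malT-fields-singletons (nothing ∷ r) = malT-fields-singletons r
  malT-fields-singletons (just u ∷ r) = cong (mal u ∷_) (malT-fields-singletons r)

  prod-singletons-[]≔ : ∀ {n} (r : Vec (Maybe S) n) d R →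
                        prod (singletons r [ d ]≔ just R) ≡ map (λ v → r [ d ]≔ just v) R
  prod-singletons-[]≔ (m ∷ r) zero R rewrite prod-singletons r =
    trans (sym (concatMap-map [_] (λ v → just v ∷ r) R)) (concatMap-pure (map (λ v → just v ∷ r) R))
  prod-singletons-[]≔ (nothing ∷ r) (suc d) R rewrite prod-singletons-[]≔ r d R = sym (map-∘ R)
  prod-singletons-[]≔ (just u ∷ r) (suc d) R rewrite prod-singletons-[]≔ r d R =
    trans (++-identityʳ _) (sym (map-∘ R))

  recT-singletons-[]≔ : ∀ (r : Vec (Maybe S) nD) d R →
                        recT (singletons r [ d ]≔ just R) ≡ map (λ v → rec (r [ d ]≔ just v)) R
  recT-singletons-[]≔ r d R = trans (cong (map rec) (prod-singletons-[]≔ r d R)) (sym (map-∘ R))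

  []≔-lookup-just : ∀ {n} (r : Vec (Maybe S) n) d {u} → lookup r d ≡ just u → r [ d ]≔ just u ≡ r
  []≔-lookup-just r d eq = trans (cong (r [ d ]≔_) (sym eq)) ([]≔-lookup r d)

  ⟶⇒≥ : ∀ {u R} → WF u → u ⟶ R → R ≤ₜ [ u ]
  ⟶⇒≥ _ (r-desCon c u) = desCon₂ c [ u ]
  ⟶⇒≥ _ (r-fldRec d r u eq) =
    subst (λ t → [ u ] ≤ₜ fldT d t) (recT-singletons r)
      (fldRec d (singletons r) [ u ] (lookup-singletons r d eq))
  ⟶⇒≥ (des (rec ne _)) (r-desRec c r) =
    subst (λ t → [] ≤ₜ desT c t) (recT-singletons r) (desRec₂ c (singletons r) (nonEmpty-singletons r ne))
  ⟶⇒≥ _ (r-fldCon d c u) = fldCon₂ d c [ u ]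
  ⟶⇒≥ (fld (rec ne _)) (r-fldRecNo d r eq) =
    subst (λ t → [] ≤ₜ fldT d t) (recT-singletons r)
      (fldRecNo₂ d (singletons r) (nonEmpty-singletons r ne) (lookup-singletons r d eq))
  ⟶⇒≥ _ (r-desCon' c c' u c≢c') = desCon'₂ c c' [ u ] c≢c'
  ⟶⇒≥ _ (r-desMal c u) = desMal₂ c [ u ]
  ⟶⇒≥ _ (r-fldMal d u) = fldMal₂ d [ u ]
  ⟶⇒≥ _ (r-malCon c u) = malCon₂ c [ u ]
  ⟶⇒≥ _ (r-malRec r ne) =
    subst₂ _≤ₜ_ (malT-fields-singletons r) (cong malT (recT-singletons r))
      (malRec (singletons r) (nonEmpty-singletons r ne))
  ⟶⇒≥ _ (r-malMal u) = malMal₂ [ u ]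
  ⟶⇒≥ (con w) (c-con c u⟶R) = ctx-con c (⟶⇒≥ w u⟶R)
  ⟶⇒≥ (des w) (c-des c u⟶R) = ctx-des c (⟶⇒≥ w u⟶R)
  ⟶⇒≥ (fld w) (c-fld d u⟶R) = ctx-fld d (⟶⇒≥ w u⟶R)
  ⟶⇒≥ (app w) (c-app g u⟶R) = ctx-app g (⟶⇒≥ w u⟶R)
  ⟶⇒≥ (mal w) (c-mal u⟶R) = ctx-mal (⟶⇒≥ w u⟶R)
  ⟶⇒≥ (rec _ ws) (c-rec r d {u} {R} eq u⟶R) =
    subst₂ _≤ₜ_ (recT-singletons-[]≔ r d R)
      (trans (recT-singletons-[]≔ r d [ u ]) (cong (λ r′ → [ rec r′ ]) ([]≔-lookup-just r d eq)))
      (ctx-rec (singletons r) d (⟶⇒≥ (ws d u eq) u⟶R))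

  ≈ₜ-refl : ∀ {t} → t ≈ₜ t
  ≈ₜ-refl _ = (λ m → m) , (λ m → m)

  ≈ₜ-sym : ∀ {t s} → t ≈ₜ s → s ≈ₜ t
  ≈ₜ-sym t≈s u = proj₂ (t≈s u) , proj₁ (t≈s u)

  ++-comm-≈ₜ : ∀ t s → (t ++ s) ≈ₜ (s ++ t)
  ++-comm-≈ₜ t s u = ∈-resp-↭ (++-comm t s) , ∈-resp-↭ (++-comm s t)

  ⟶ₜ⇒≥ : ∀ t s → WFₜ t → t ⟶ₜ s → s ≤ₜ t
  ⟶ₜ⇒≥ t s wt (step u R rest u⟶R _ t≈ s≈) =
    ≤-trans (≈⇒≤ s≈) (≤-trans (≈⇒≤ (++-comm-≈ₜ rest R))
      (≤-trans (ctx-sum rest (⟶⇒≥ (All.lookup wt (proj₂ (t≈ u) (here refl))) u⟶R))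
        (≈⇒≤ (≈ₜ-sym t≈))))

  size : S → ℕ
  sizeᵛ : ∀ {n} → Vec (Maybe S) n → ℕ
  size (con c u) = suc (size u)
  size (rec r) = suc (sizeᵛ r)
  size (des c u) = suc (size u)
  size (fld d u) = suc (size u)
  size (app g u) = suc (size u)
  size var = 1
  size (mal u) = suc (size u)
  sizeᵛ [] = 0
  sizeᵛ (nothing ∷ r) = sizeᵛ r
  sizeᵛ (just u ∷ r) = size u + sizeᵛ r

  size-lookup : ∀ {n} (r : Vec (Maybe S) n) d {u} → lookup r d ≡ just u → size u ≤ sizeᵛ r
  size-lookup (just u ∷ r) zero refl = ℕₚ.m≤m+n (size u) (sizeᵛ r)
  size-lookup (nothing ∷ r) (suc d) eq = size-lookup r d eq
  size-lookup (just v ∷ r) (suc d) eq = ℕₚ.≤-trans (size-lookup r d eq) (ℕₚ.m≤n+m (sizeᵛ r) (size v))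

  size-fields : ∀ {n} (r : Vec (Maybe S) n) → All (λ v → size v ≤ sizeᵛ r) (fields r)
  size-fields [] = []
  size-fields (nothing ∷ r) = size-fields r
  size-fields (just u ∷ r) =
    ℕₚ.m≤m+n _ _ ∷ All.map (λ le → ℕₚ.≤-trans le (ℕₚ.m≤n+m _ (size u))) (size-fields r)

  sizeᵛ-[]≔ : ∀ {n} (r : Vec (Maybe S) n) d {u v} → lookup r d ≡ just u → size v < size u →
              sizeᵛ (r [ d ]≔ just v) < sizeᵛ r
  sizeᵛ-[]≔ (just u ∷ r) zero refl lt = ℕₚ.+-monoˡ-< (sizeᵛ r) lt
  sizeᵛ-[]≔ (nothing ∷ r) (suc d) eq lt = sizeᵛ-[]≔ r d eq lt
  sizeᵛ-[]≔ (just w ∷ r) (suc d) eq lt = ℕₚ.+-monoʳ-< (size w) (sizeᵛ-[]≔ r d eq lt)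

  ⟶-size : ∀ {u R} → u ⟶ R → All (λ v → size v < size u) R
  ⟶-size (r-desCon c u) = s≤s (ℕₚ.n≤1+n _) ∷ []
  ⟶-size (r-fldRec d r u eq) = s≤s (ℕₚ.≤-trans (size-lookup r d eq) (ℕₚ.n≤1+n _)) ∷ []
  ⟶-size (r-desRec c r) = []
  ⟶-size (r-fldCon d c u) = []
  ⟶-size (r-fldRecNo d r _) = []
  ⟶-size (r-desCon' c c' u _) = []
  ⟶-size (r-desMal c u) = ℕₚ.n<1+n _ ∷ []
  ⟶-size (r-fldMal d u) = ℕₚ.n<1+n _ ∷ []
  ⟶-size (r-malCon c u) = ℕₚ.n<1+n _ ∷ []
  ⟶-size (r-malRec r _) = map⁺ (All.map (λ le → s≤s (s≤s le)) (size-fields r))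
  ⟶-size (r-malMal u) = ℕₚ.n<1+n _ ∷ []
  ⟶-size (c-con c u⟶R) = map⁺ (All.map s≤s (⟶-size u⟶R))
  ⟶-size (c-des c u⟶R) = map⁺ (All.map s≤s (⟶-size u⟶R))
  ⟶-size (c-fld d u⟶R) = map⁺ (All.map s≤s (⟶-size u⟶R))
  ⟶-size (c-app g u⟶R) = map⁺ (All.map s≤s (⟶-size u⟶R))
  ⟶-size (c-mal u⟶R) = map⁺ (All.map s≤s (⟶-size u⟶R))
  ⟶-size (c-rec r d eq u⟶R) = map⁺ (All.map (λ lt → s≤s (sizeᵛ-[]≔ r d eq lt)) (⟶-size u⟶R))

  open FiniteSetExtension (_<_ on size)

  ⟶ₜ⇒⊏ : ∀ {t s} → t ⟶ₜ s → s ⊏ t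
  ⟶ₜ⇒⊏ {t} {s} (step u R rest u⟶R u∉rest t≈ s≈) = u , proj₂ (t≈ u) (here refl) , below
    where
    below : ∀ {z} → z ∈ s → (z ∈ t × z ≢ u) ⊎ size z < size u
    below {z} z∈s with ∈-++⁻ rest (proj₁ (s≈ z) z∈s)
    ... | inj₁ z∈rest = inj₁ (proj₂ (t≈ z) (there z∈rest) , λ { refl → u∉rest z∈rest })
    ... | inj₂ z∈R = inj₂ (All.lookup (⟶-size u⟶R) z∈R)

  ⟶ₜ-acc : ∀ t → WFₜ t → Acc (flip _⟶ₜ_) t
  ⟶ₜ-acc t _ = Subrelation.accessible ⟶ₜ⇒⊏ (⊏-wellFounded (wellFounded size <-wellFounded) t)

  Irreducible : S → Set
  Irreducible u = ∀ {R} → ¬ u ⟶ R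

  NT⇒irreducible : ∀ {u} → NT u → Irreducible u
  Nδ⇒irreducible : ∀ {u} → Nδ u → Irreducible u
  NT⇒irreducible (con nt) (c-con c u⟶R) = NT⇒irreducible nt u⟶R
  NT⇒irreducible (rec _ nts) (c-rec r d eq u⟶R) = NT⇒irreducible (nts d _ eq) u⟶R
  NT⇒irreducible (mal ()) (r-malCon c u)
  NT⇒irreducible (mal ()) (r-malRec r _)
  NT⇒irreducible (mal ()) (r-malMal u)
  NT⇒irreducible (mal nδ) (c-mal u⟶R) = Nδ⇒irreducible nδ u⟶R
  NT⇒irreducible (δ nδ) u⟶R = Nδ⇒irreducible nδ u⟶R
  Nδ⇒irreducible (des ()) (r-desCon c u)
  Nδ⇒irreducible (des ()) (r-desRec c r)
  Nδ⇒irreducible (des ()) (r-desCon' c c' u _)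
  Nδ⇒irreducible (des ()) (r-desMal c u)
  Nδ⇒irreducible (des nδ) (c-des c u⟶R) = Nδ⇒irreducible nδ u⟶R
  Nδ⇒irreducible (fld ()) (r-fldRec d r u _)
  Nδ⇒irreducible (fld ()) (r-fldCon d c u)
  Nδ⇒irreducible (fld ()) (r-fldRecNo d r _)
  Nδ⇒irreducible (fld ()) (r-fldMal d u)
  Nδ⇒irreducible (fld nδ) (c-fld d u⟶R) = Nδ⇒irreducible nδ u⟶R
  Nδ⇒irreducible (app nt) (c-app g u⟶R) = NT⇒irreducible nt u⟶R

  mal-irreducible⇒Nδ : ∀ {u} → NT u → Irreducible (mal u) → Nδ u
  mal-irreducible⇒Nδ (con {c} {u} _) irr = ⊥-elim (irr (r-malCon c u))
  mal-irreducible⇒Nδ (rec {r} ne _) irr = ⊥-elim (irr (r-malRec r ne))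
  mal-irreducible⇒Nδ (mal {u} _) irr = ⊥-elim (irr (r-malMal u))
  mal-irreducible⇒Nδ (δ nδ) _ = nδ

  des-irreducible⇒Nδ : ∀ {c u} → NT u → Irreducible (des c u) → Nδ u
  des-irreducible⇒Nδ {c} (con {c′} {u} _) irr with c ≟ c′
  ... | yes refl = ⊥-elim (irr (r-desCon c u))
  ... | no c≢c′ = ⊥-elim (irr (r-desCon' c c′ u c≢c′))
  des-irreducible⇒Nδ {c} (rec {r} _ _) irr = ⊥-elim (irr (r-desRec c r))
  des-irreducible⇒Nδ {c} (mal {u} _) irr = ⊥-elim (irr (r-desMal c u))
  des-irreducible⇒Nδ (δ nδ) _ = nδ

  fld-irreducible⇒Nδ : ∀ {d u} → NT u → Irreducible (fld d u) → Nδ u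
  fld-irreducible⇒Nδ {d} (con {c} {u} _) irr = ⊥-elim (irr (r-fldCon d c u))
  fld-irreducible⇒Nδ {d} (rec {r} _ _) irr with lookup r d in eq
  ... | just u = ⊥-elim (irr (r-fldRec d r u eq))
  ... | nothing = ⊥-elim (irr (r-fldRecNo d r eq))
  fld-irreducible⇒Nδ {d} (mal {u} _) irr = ⊥-elim (irr (r-fldMal d u))
  fld-irreducible⇒Nδ (δ nδ) _ = nδ

  irreducible⇒NT : ∀ {u} → WF u → Irreducible u → NT u
  irreducible⇒NT (con {c} w) irr = con (irreducible⇒NT w λ u⟶R → irr (c-con c u⟶R))
  irreducible⇒NT (rec {r} ne ws) irr =
    rec ne λ d u eq → irreducible⇒NT (ws d u eq) λ u⟶R → irr (c-rec r d eq u⟶R)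
  irreducible⇒NT (mal w) irr =
    mal (mal-irreducible⇒Nδ (irreducible⇒NT w λ u⟶R → irr (c-mal u⟶R)) irr)
  irreducible⇒NT (des {c} w) irr =
    δ (des (des-irreducible⇒Nδ (irreducible⇒NT w λ u⟶R → irr (c-des c u⟶R)) irr))
  irreducible⇒NT (fld {d} w) irr =
    δ (fld (fld-irreducible⇒Nδ (irreducible⇒NT w λ u⟶R → irr (c-fld d u⟶R)) irr))
  irreducible⇒NT (app {g} w) irr = δ (app (irreducible⇒NT w λ u⟶R → irr (c-app g u⟶R)))
  irreducible⇒NT var _ = δ var

  irreducible⇔NT : ∀ {u} → WF u → Irreducible u ⇔ NT u
  irreducible⇔NT w = mk⇔ (irreducible⇒NT w) NT⇒irreducible

  normal[]⇔irreducible : ∀ u → Normalₜ [ u ] ⇔ Irreducible u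
  normal[]⇔irreducible u = mk⇔
    (λ normal {R} u⟶R → normal R (step u R [] u⟶R (λ ()) ≈ₜ-refl ≈ₜ-refl))
    (λ { irr s (step v R rest v⟶R _ [u]≈ _) → irreducible-∈[] (proj₂ ([u]≈ v) (here refl)) irr v⟶R })
    where
    irreducible-∈[] : ∀ {v} → v ∈ [ u ] → Irreducible u → Irreducible v
    irreducible-∈[] (here refl) irr = irr

mainTheorem3 : (nC nD nG : ℕ) → let open F0 nC nD nG in
    (∀ t s → WFₜ t → t ⟶ₜ s → s ≤ₜ t)
    × (∀ t → WFₜ t → Acc (flip _⟶ₜ_) t)
    × (∀ u → WF u → (Normalₜ [ u ] ⇔ NT u))
mainTheorem3 nC nD nG =
  ⟶ₜ⇒≥ nC nD nG , ⟶ₜ-acc nC nD nG ,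
  λ u w → irreducible⇔NT nC nD nG w ⇔-∘ normal[]⇔irreducible nC nD nG u
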